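{- Let $k,m$ be positive integers, $S_1,\dots,S_m\subseteq[k]\times[k]$ sets each containing at most one element from each row, and $G$ the graph constructed from them as described in the context. If there is a matching $M$ in $G$ with $|M|\ge 3k+m$ such that $G[V_M]$ has at least $k$ connected components, then there exists a set $\widehat S\subseteq[k]\times[k]$ containing exactly one element from each row with $\widehat S\cap S_s\neq\emptyset$ for every $s\in[m]$.
   Context: A row of $[k]\times[k]$ is a set $\{i\}\times[k]$. Construction: let $P_i=\{i\}\times[k]$ for $i\in[k]$, and let $\mathcal{S}$ be the family consisting of the $m$ sets $S_1,\dots,S_m$ and the $k$ sets $P_1,\dots,P_k$ (treated as $k+m$ distinct members). The graph $H$ has vertices $v_i^L$ ($i\in[k]$), $v_j^R$ ($j\in[k]$), and for every $X\in\mathcal{S}$ and $(i,j)\in X$ a vertex $v_{i,j}^X$; its edges are $v_i^Lv_{i,j}^X$ and $v_{i,j}^Xv_j^R$ for all $X\in\mathcal{S}$ and $(i,j)\in X$. The graph $G$ is obtained from $H$ by adding, for each $i\in[k]$, a new vertex $u_i^L$ adjacent only to $v_i^L$; for each $j\in[k]$, a new vertex $u_j^R$ adjacent only to $v_j^R$; and for each $X\in\mathcal{S}$, a new vertex $u^X$ adjacent exactly to the vertices $v_{i,j}^X$, $(i,j)\in X$. For a matching $M$ (set of pairwise disjoint edges), $V_M$ is the set of endpoints of its edges and $G[V_M]$ the induced subgraph. -}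

module Defs where

open import Data.Nat using (ℕ)
open import Data.Fin using (Fin)
open import Data.Bool using (Bool; true; T)
open import Data.Sum using (_⊎_; inj₁; inj₂)
open import Data.Product using (Σ; ∃; ∃-syntax; _×_; _,_)
open import Data.List using (List)
open import Data.List.Membership.Propositional using (_∈_)
open import Data.List.Relation.Unary.AllPairs using (AllPairs)
open import Relation.Binary.PropositionalEquality using (_≡_)
open import Relation.Nullary using (¬_)
open import Relation.Binary.Construct.Closure.ReflexiveTransitive using (Star)

-- A subset of [k]×[k] is a Bool-valued predicate on Fin k × Fin k
-- (first coordinate = row).
Subset² : ℕ → Set
Subset² k = Fin k → Fin k → Bool

AtMostOnePerRow : {k : ℕ} → Subset² k → Set
AtMostOnePerRow {k} X = ∀ (i j j' : Fin k) → T (X i j) → T (X i j') → j ≡ j'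

ExactlyOnePerRow : {k : ℕ} → Subset² k → Set
ExactlyOnePerRow {k} X =
  ∀ (i : Fin k) → ∃[ j ] (T (X i j) × (∀ (j' : Fin k) → T (X i j') → j' ≡ j))

module Construction (k m : ℕ) (S : Fin m → Subset² k) where

  -- Index set of the family 𝒮: inj₁ s is S_s, inj₂ i is the row P_i
  -- (k+m distinct members).
  Idx : Set
  Idx = Fin m ⊎ Fin k

  Mem : Idx → Fin k → Fin k → Set
  Mem (inj₁ s) i j = T (S s i j)
  Mem (inj₂ i') i j = i ≡ i'

  data V : Set where
    vL : Fin k → V
    vR : Fin k → V
    vX : (X : Idx) (i j : Fin k) → Mem X i j → V
    uL : Fin k → V
    uR : Fin k → V
    uX : Idx → V

  data E : V → V → Set where
    L-X : ∀ X i j (p : Mem X i j) → E (vL i) (vX X i j p)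
    X-R : ∀ X i j (p : Mem X i j) → E (vX X i j p) (vR j)
    uL-L : ∀ i → E (uL i) (vL i)
    uR-R : ∀ j → E (uR j) (vR j)
    uX-X : ∀ X i j (p : Mem X i j) → E (uX X) (vX X i j p)

  Adj : V → V → Set
  Adj a b = E a b ⊎ E b a

  Edge : Set
  Edge = Σ (V × V) (λ { (a , b) → Adj a b })

  endpoint : V → Edge → Set
  endpoint w ((a , b) , _) = (w ≡ a) ⊎ (w ≡ b)

  Disjoint : Edge → Edge → Set
  Disjoint e f = ∀ (w : V) → endpoint w e → ¬ endpoint w f

  -- a matching: a list of pairwise disjoint edges (hence pairwise distinct);
  -- |M| is the length of the list
  IsMatching : List Edge → Set
  IsMatching M = AllPairs Disjoint M

  InVM : List Edge → V → Set
  InVM M w = ∃[ e ] (e ∈ M × endpoint w e)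

  AdjIn : List Edge → V → V → Set
  AdjIn M a b = InVM M a × InVM M b × Adj a b

  ConnIn : List Edge → V → V → Set
  ConnIn M = Star (AdjIn M)

  -- G[V_M] has at least n connected components: there are n vertices of V_M
  -- lying in pairwise distinct components
  AtLeastComponents : List Edge → ℕ → Set
  AtLeastComponents M n =
    Σ (Fin n → V) λ w → ((∀ (t : Fin n) → InVM M (w t)) ×
            (∀ (t t' : Fin n) → ¬ (t ≡ t') → ¬ ConnIn M (w t) (w t')))

-- The k + k + (m + k) = 3k + m vertices v_i^L, v_j^R and u^X meet every edge of G, so a
-- matching with 3k + m edges saturates each of them.  In G[V_M] every vertex is then joined
-- to some v_j^R, hence k components force the k vertices v_j^R into pairwise different
-- components.  The partner of u^{P_i} joins v_i^L to some v_{σ(i)}^R, and the partner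
-- v_{i,j}^{S_s} of u^{S_s} joins v_i^L to v_j^R, which forces j = σ(i).  So the graph of σ
-- is the required set Ŝ.
module Submission where

open import Defs
open import Data.Nat using (ℕ; _≤_; _+_; _*_; suc; s<s)
open import Data.Nat.Properties using (<⇒≱; ≤-refl; ≤-trans; ≤-reflexive)
open import Data.Nat.Solver using (module +-*-Solver)
open import Data.Fin using (Fin; _≟_; _<_; punchOut; zero; suc)
open import Data.Fin.Properties using (any?; punchOut-injective; injective⇒≤; <-cmp; +↔⊎)
open import Data.Bool using (T)
open import Data.Product using (∃; ∃-syntax; Σ; _×_; _,_; proj₁; proj₂)
open import Data.Sum using (_⊎_; inj₁; inj₂; swap)
open import Data.Sum.Function.Propositional using (_⊎-↔_)
open import Data.List using (List; length; lookup)
import Data.List.Relation.Unary.All as All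
open import Data.List.Relation.Unary.AllPairs as AllPairs using (AllPairs; _∷_)
open import Data.List.Membership.Propositional using (_∈_)
open import Data.List.Membership.Propositional.Properties using (∈-lookup)
open import Function using (_∘_; _↣_; Injection)
open import Function.Definitions using (Injective; StrictlySurjective)
open import Function.Properties.Inverse using (↔-refl; ↔-sym; ↔-trans; ↔⇒↣)
open import Relation.Binary.Definitions using (tri<; tri≈; tri>)
open import Relation.Binary.PropositionalEquality using (_≡_; _≢_; refl; sym; subst)
open import Relation.Nullary using (¬_; contradiction; yes; no)
open import Relation.Nullary.Decidable using (⌊_⌋; toWitness; fromWitness; decidable-stable)
open import Relation.Binary.Construct.Closure.ReflexiveTransitive using (ε; _◅_; _◅◅_; reverse)

injective⇒strictlySurjective : ∀ {m n} {f : Fin n → Fin m} → m ≤ n →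
                               Injective _≡_ _≡_ f → StrictlySurjective _≡_ f
injective⇒strictlySurjective {suc m} {n} {f} m<n f-injective y with any? (λ x → f x ≟ y)
... | yes hit = hit
... | no ¬hit = contradiction (injective⇒≤ punched-injective) (<⇒≱ m<n)
  where
    punched : Fin n → Fin m
    punched x = punchOut {i = y} {j = f x} (λ y≡fx → ¬hit (x , sym y≡fx))

    punched-injective : Injective _≡_ _≡_ punched
    punched-injective {x} {x′} eq = f-injective (punchOut-injective {i = y} {j = f x} {k = f x′} _ _ eq)

allPairs-lookup : ∀ {a r} {A : Set a} {R : A → A → Set r} {xs : List A} →
                  AllPairs R xs → ∀ {i j} → i < j → R (lookup xs i) (lookup xs j)
allPairs-lookup (Rx ∷ _)    {zero}  {suc j} _         = All.lookup Rx (∈-lookup j)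
allPairs-lookup (_ ∷ pairs) {suc i} {suc j} (s<s i<j) = allPairs-lookup pairs i<j

allPairs-≢⇒covers : ∀ {a b n} {A : Set a} {B : Set b} (ι : B ↣ Fin n) {f : A → B} (xs : List A) →
                    n ≤ length xs → AllPairs (λ x y → f x ≢ f y) xs →
                    ∀ y → ∃ λ x → x ∈ xs × f x ≡ y
allPairs-≢⇒covers {n = n} ι {f} xs n≤|xs| distinct y =
  let i , Fi≡ιy = injective⇒strictlySurjective n≤|xs| F-injective (to y)
  in  lookup xs i , ∈-lookup i , injective Fi≡ιy
  where
    open Injection ι

    F : Fin (length xs) → Fin n
    F = to ∘ f ∘ lookup xs

    F-injective : Injective _≡_ _≡_ F
    F-injective {i} {j} Fi≡Fj with <-cmp i j
    ... | tri< i<j _ _   = contradiction (injective Fi≡Fj) (allPairs-lookup distinct i<j)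
    ... | tri≈ _ i≡j _   = i≡j
    ... | tri> _ _ j<i   = contradiction (sym (injective Fi≡Fj)) (allPairs-lookup distinct j<i)

graph : ∀ {k} → (Fin k → Fin k) → Subset² k
graph σ i j = ⌊ σ i ≟ j ⌋

graph-exactlyOnePerRow : ∀ {k} (σ : Fin k → Fin k) → ExactlyOnePerRow (graph σ)
graph-exactlyOnePerRow σ i =
  σ i , fromWitness refl , λ j σij → sym (toWitness {a? = σ i ≟ j} σij)

3k+m≡|Cover| : ∀ k m → 3 * k + m ≡ k + (k + (m + k))
3k+m≡|Cover| = solve 2 (λ k m → con 3 :* k :+ m := k :+ (k :+ (m :+ k))) refl
  where open +-*-Solver

module ConstructionProperties (k m : ℕ) (S : Fin m → Subset² k) where
  open Construction k m S

  Cover : Set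
  Cover = Fin k ⊎ Fin k ⊎ Idx

  Cover↣Fin : Cover ↣ Fin (k + (k + (m + k)))
  Cover↣Fin = ↔⇒↣ (↔-sym (↔-trans +↔⊎ (↔-refl ⊎-↔ ↔-trans +↔⊎ (↔-refl ⊎-↔ +↔⊎))))

  coverVertex : Cover → V
  coverVertex (inj₁ i)        = vL i
  coverVertex (inj₂ (inj₁ j)) = vR j
  coverVertex (inj₂ (inj₂ X)) = uX X

  coverE : ∀ {a b} → E a b → Cover
  coverE (L-X X i j p)  = inj₁ i
  coverE (X-R X i j p)  = inj₂ (inj₁ j)
  coverE (uL-L i)       = inj₁ i
  coverE (uR-R j)       = inj₂ (inj₁ j)
  coverE (uX-X X i j p) = inj₂ (inj₂ X)

  coverE-endpoint : ∀ {a b} (e : E a b) → coverVertex (coverE e) ≡ a ⊎ coverVertex (coverE e) ≡ b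
  coverE-endpoint (L-X X i j p)  = inj₁ refl
  coverE-endpoint (X-R X i j p)  = inj₂ refl
  coverE-endpoint (uL-L i)       = inj₂ refl
  coverE-endpoint (uR-R j)       = inj₂ refl
  coverE-endpoint (uX-X X i j p) = inj₁ refl

  coverOf : Edge → Cover
  coverOf (_ , inj₁ e) = coverE e
  coverOf (_ , inj₂ e) = coverE e

  coverOf-endpoint : ∀ e → endpoint (coverVertex (coverOf e)) e
  coverOf-endpoint ((a , b) , inj₁ e) = coverE-endpoint e
  coverOf-endpoint ((a , b) , inj₂ e) = swap (coverE-endpoint e)

  disjoint⇒coverOf-≢ : ∀ {e f} → Disjoint e f → coverOf e ≢ coverOf f
  disjoint⇒coverOf-≢ {e} {f} e#f eq =
    e#f _ (coverOf-endpoint e) (subst (λ c → endpoint (coverVertex c) f) (sym eq) (coverOf-endpoint f))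

  otherEndpoint : ∀ {w} e → endpoint w e → ∃ λ w′ → endpoint w′ e × Adj w w′
  otherEndpoint ((a , b) , ab) (inj₁ refl) = b , inj₂ refl , ab
  otherEndpoint ((a , b) , ab) (inj₂ refl) = a , inj₁ refl , swap ab

  uX-neighbour : ∀ {X w} → Adj (uX X) w → ∃ λ i → ∃ λ j → Σ (Mem X i j) λ p → w ≡ vX X i j p
  uX-neighbour (inj₁ (uX-X X i j p)) = i , j , p , refl
  uX-neighbour (inj₂ ())

  module _ (M : List Edge) where

    AdjIn-sym : ∀ {a b} → AdjIn M a b → AdjIn M b a
    AdjIn-sym (a∈ , b∈ , ab) = b∈ , a∈ , swap ab

    ConnIn-sym : ∀ {a b} → ConnIn M a b → ConnIn M b a
    ConnIn-sym = reverse AdjIn-sym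

    matchedNeighbour : ∀ {X} → InVM M (uX X) →
                       ∃ λ i → ∃ λ j → Σ (Mem X i j) λ p → AdjIn M (uX X) (vX X i j p)
    matchedNeighbour u∈@(e , e∈M , u-e) with otherEndpoint e u-e
    ... | w , w-e , uw with uX-neighbour uw
    ...   | i , j , p , refl = i , j , p , u∈ , (e , e∈M , w-e) , uw

    module Saturated (matching : IsMatching M) (large : 3 * k + m ≤ length M) where

      cover-saturated : ∀ c → InVM M (coverVertex c)
      cover-saturated c
        with e , e∈M , e↦c ← allPairs-≢⇒covers Cover↣Fin {coverOf} M
                               (≤-trans (≤-reflexive (sym (3k+m≡|Cover| k m))) large)
                               (AllPairs.map (λ {e f} → disjoint⇒coverOf-≢ {e} {f}) matching) c
        = e , e∈M , subst (λ c → endpoint (coverVertex c) e) e↦c (coverOf-endpoint e)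

      vL∈ : ∀ i → InVM M (vL i)
      vL∈ i = cover-saturated (inj₁ i)

      vR∈ : ∀ j → InVM M (vR j)
      vR∈ j = cover-saturated (inj₂ (inj₁ j))

      matchedMember : ∀ X → ∃ λ i → ∃ λ j → Σ (Mem X i j) λ p → InVM M (vX X i j p)
      matchedMember X =
        let i , j , p , _ , x∈ , _ = matchedNeighbour (cover-saturated (inj₂ (inj₂ X)))
        in  i , j , p , x∈

      vX-joins : ∀ {X i j} {p : Mem X i j} → InVM M (vX X i j p) → ConnIn M (vL i) (vR j)
      vX-joins {X} {i} {j} {p} x∈ =
        (vL∈ i , x∈ , inj₁ (L-X X i j p)) ◅ (x∈ , vR∈ j , inj₁ (X-R X i j p)) ◅ ε

      rowPath : ∀ i → ∃ λ j → ConnIn M (vL i) (vR j)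
      rowPath i =
        let i′ , j , i′≡i , x∈ = matchedMember (inj₂ i)
        in  j , subst (λ r → ConnIn M (vL r) (vR j)) i′≡i (vX-joins x∈)

      σ : Fin k → Fin k
      σ i = proj₁ (rowPath i)

      reachesRight : ∀ w → InVM M w → ∃ λ j → ConnIn M w (vR j)
      reachesRight (vL i)       _  = rowPath i
      reachesRight (vR j)       _  = j , ε
      reachesRight (vX X i j p) x∈ = j , (x∈ , vR∈ j , inj₁ (X-R X i j p)) ◅ ε
      reachesRight (uL i)       u∈ = σ i , (u∈ , vL∈ i , inj₁ (uL-L i)) ◅ proj₂ (rowPath i)
      reachesRight (uR j)       u∈ = j , (u∈ , vR∈ j , inj₁ (uR-R j)) ◅ ε
      reachesRight (uX X)       u∈ with i , j , p , ux@(_ , x∈ , _) ← matchedNeighbour u∈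
        = j , ux ◅ (x∈ , vR∈ j , inj₁ (X-R X i j p)) ◅ ε

      module _ (components : AtLeastComponents M k) where
        open Σ components renaming (proj₁ to w; proj₂ to w-props)

        representative : Fin k → Fin k
        representative t = proj₁ (reachesRight (w t) (proj₁ w-props t))

        toRepresentative : ∀ t → ConnIn M (w t) (vR (representative t))
        toRepresentative t = proj₂ (reachesRight (w t) (proj₁ w-props t))

        representative-injective : Injective _≡_ _≡_ representative
        representative-injective {t} {t′} eq = decidable-stable (t ≟ t′) λ t≢t′ →
          proj₂ w-props t t′ t≢t′
            (toRepresentative t ◅◅ subst (λ j → ConnIn M (vR j) (w t′)) (sym eq) (ConnIn-sym (toRepresentative t′)))

        representative-surjective : StrictlySurjective _≡_ representative
        representative-surjective = injective⇒strictlySurjective ≤-refl representative-injective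

        vR-separated : ∀ {j j′} → j ≢ j′ → ¬ ConnIn M (vR j) (vR j′)
        vR-separated {j} {j′} j≢j′ path
          with t , refl ← representative-surjective j | t′ , refl ← representative-surjective j′
          = proj₂ w-props t t′ (λ { refl → j≢j′ refl })
              (toRepresentative t ◅◅ path ◅◅ ConnIn-sym (toRepresentative t′))

        σ-meets : ∀ s → ∃[ i ] ∃[ j ] (T (S s i j) × σ i ≡ j)
        σ-meets s =
          let i , j , Ssij , x∈ = matchedMember (inj₁ s)
          in  i , j , Ssij , decidable-stable (σ i ≟ j) λ σi≢j →
              vR-separated σi≢j (ConnIn-sym (proj₂ (rowPath i)) ◅◅ vX-joins x∈)

lemma9 : (k m : ℕ) → 1 ≤ k → 1 ≤ m →
    (S : Fin m → Subset² k) →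
    (∀ (s : Fin m) → AtMostOnePerRow (S s)) →
    (M : List (Construction.Edge k m S)) →
    Construction.IsMatching k m S M →
    3 * k + m ≤ length M →
    Construction.AtLeastComponents k m S M k →
    ∃[ Ŝ ] (ExactlyOnePerRow {k} Ŝ ×
    (∀ (s : Fin m) → ∃[ i ] ∃[ j ] (T (S s i j) × T (Ŝ i j))))
lemma9 k m _ _ S _ M matching large components =
  graph σ , graph-exactlyOnePerRow σ , hits
  where
    open ConstructionProperties k m S
    open Saturated M matching large

    hits : ∀ s → ∃[ i ] ∃[ j ] (T (S s i j) × T (graph σ i j))
    hits s = let i , j , Ssij , σi≡j = σ-meets components s in i , j , Ssij , fromWitness σi≡j
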